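{- Let $s$ be a state of the canonical model $\mathcal{M}^c$ of $\mathbb{LUT}$, $i$ an agent and $\psi$ a formula. Then $K_i\psi\in s$ if and only if for every $t\in S^c$ with $sR^c_it$, $\psi\in t$.
   Context: The language $\mathbf{LUT}$ over a countably infinite set $\mathbf{P}$ of propositional variables and a finite set $\mathbf{I}$ of agents is $\phi::= p\mid\neg\phi\mid(\phi\land\phi)\mid K_i\phi\mid[\phi]\phi\mid U_i\phi$; $\mathbf{EL}$ is the fragment without $[\cdot]$ and $U_i$. Admissible forms: $\eta(\sharp)::=\sharp\mid\phi\to\eta(\sharp)\mid K_i\eta(\sharp)\mid[\phi]\eta(\sharp)$; $\eta(\chi)$ denotes the result of replacing $\sharp$ by $\chi$. The proof system $\mathbb{LUT}$ has axioms: propositional tautologies; $K_i(\phi\to\psi)\to(K_i\phi\to K_i\psi)$; $[\chi](\phi\to\psi)\to([\chi]\phi\to[\chi]\psi)$; $K_i\phi\to\phi$; $[\psi]p\leftrightarrow(\psi\to p)$; $[\psi]\neg\phi\leftrightarrow(\psi\to\neg[\psi]\phi)$; $[\psi](\phi\land\chi)\leftrightarrow([\psi]\phi\land[\psi]\chi)$; $[\psi]K_i\phi\leftrightarrow(\psi\to K_i[\psi]\phi)$; $[\psi][\chi]\phi\leftrightarrow[\psi\land[\psi]\chi]\phi$; $U_i\phi\to\phi\land[\psi]\neg K_i\phi$ for each $\psi\in\mathbf{EL}$; rules: modus ponens (MP), $\phi/K_i\phi$, $\phi/[\chi]\phi$, and RU: from $\eta(\phi\land[\psi]\neg K_i\phi)$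 for all $\psi\in\mathbf{EL}$ infer $\eta(U_i\phi)$, for any admissible form $\eta$. Let $\mathbf{Thm}$ be its set of theorems. A set of formulas $s$ is a theory if $\mathbf{Thm}\subseteq s$ and $s$ is closed under MP and RU (if $\eta(\phi\land[\psi]\neg K_i\phi)\in s$ for all $\psi\in\mathbf{EL}$ then $\eta(U_i\phi)\in s$); it is maximal consistent if $\bot\notin s$ and for every $\phi$ either $\phi\in s$ or $\neg\phi\in s$. The canonical model is $\mathcal{M}^c=\langle S^c,\{R^c_i\}_{i\in\mathbf{I}},V^c\rangle$, where $S^c$ is the set of all maximal consistent theories, $sR^c_it$ iff $\{\phi\mid K_i\phi\in s\}\subseteq t$, and $V^c(p)=\{s\in S^c\mid p\in s\}$. -}

module Defs where

open import Data.Nat using (ℕ; zero)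
open import Data.Fin using (Fin)
open import Data.Bool using (Bool; true; false; not; _∧_)
open import Data.Product using (_×_; Σ; _,_)
open import Data.Sum using (_⊎_)
open import Relation.Binary.PropositionalEquality using (_≡_)
open import Relation.Nullary using (¬_)

module LUT (n : ℕ) where

  Agent : Set
  Agent = Fin n

  infixr 6 _∧'_
  data Form : Set where
    var  : ℕ → Form
    ¬'   : Form → Form
    _∧'_ : Form → Form → Form
    K    : Agent → Form → Form
    [_]_ : Form → Form → Form
    U    : Agent → Form → Form

  infixr 5 _⇒_
  _⇒_ : Form → Form → Form
  φ ⇒ ψ = ¬' (φ ∧' ¬' ψ)

  _⇔_ : Form → Form → Form
  φ ⇔ ψ = (φ ⇒ ψ) ∧' (ψ ⇒ φ)

  ⊤' : Form
  ⊤' = var zero ⇒ var zero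

  ⊥' : Form
  ⊥' = ¬' ⊤'

  data IsEL : Form → Set where
    var : ∀ p → IsEL (var p)
    ¬'  : ∀ {φ} → IsEL φ → IsEL (¬' φ)
    _∧'_ : ∀ {φ ψ} → IsEL φ → IsEL ψ → IsEL (φ ∧' ψ)
    K   : ∀ i {φ} → IsEL φ → IsEL (K i φ)

  data Adm : Set where
    ♯    : Adm
    _⇒η_ : Form → Adm → Adm
    Kη   : Agent → Adm → Adm
    [_]η_ : Form → Adm → Adm

  plug : Adm → Form → Form
  plug ♯ χ = χ
  plug (φ ⇒η η) χ = φ ⇒ plug η χ
  plug (Kη i η) χ = K i (plug η χ)
  plug ([ φ ]η η) χ = [ φ ] plug η χ

  evalP : (Form → Bool) → Form → Bool
  evalP v (¬' φ) = not (evalP v φ)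
  evalP v (φ ∧' ψ) = evalP v φ ∧ evalP v ψ
  evalP v φ@(var _) = v φ
  evalP v φ@(K _ _) = v φ
  evalP v φ@([ _ ] _) = v φ
  evalP v φ@(U _ _) = v φ

  Tautology : Form → Set
  Tautology φ = ∀ (v : Form → Bool) → evalP v φ ≡ true

  data Thm : Form → Set where
    taut   : ∀ {φ} → Tautology φ → Thm φ
    axK    : ∀ i φ ψ → Thm (K i (φ ⇒ ψ) ⇒ (K i φ ⇒ K i ψ))
    axAnn  : ∀ χ φ ψ → Thm ([ χ ] (φ ⇒ ψ) ⇒ ([ χ ] φ ⇒ [ χ ] ψ))
    axT    : ∀ i φ → Thm (K i φ ⇒ φ)
    axAtom : ∀ ψ p → Thm (([ ψ ] var p) ⇔ (ψ ⇒ var p))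
    axNeg  : ∀ ψ φ → Thm (([ ψ ] ¬' φ) ⇔ (ψ ⇒ ¬' ([ ψ ] φ)))
    axConj : ∀ ψ φ χ → Thm (([ ψ ] (φ ∧' χ)) ⇔ (([ ψ ] φ) ∧' ([ ψ ] χ)))
    axAnnK : ∀ ψ i φ → Thm (([ ψ ] K i φ) ⇔ (ψ ⇒ K i ([ ψ ] φ)))
    axComp : ∀ ψ χ φ → Thm (([ ψ ] [ χ ] φ) ⇔ ([ ψ ∧' ([ ψ ] χ) ] φ))
    axU    : ∀ i φ ψ → IsEL ψ → Thm (U i φ ⇒ (φ ∧' ([ ψ ] ¬' (K i φ))))
    mp     : ∀ {φ ψ} → Thm (φ ⇒ ψ) → Thm φ → Thm ψ
    necK   : ∀ i {φ} → Thm φ → Thm (K i φ)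
    necAnn : ∀ χ {φ} → Thm φ → Thm ([ χ ] φ)
    ru     : ∀ (η : Adm) i φ
           → (∀ ψ → IsEL ψ → Thm (plug η (φ ∧' ([ ψ ] ¬' (K i φ)))))
           → Thm (plug η (U i φ))

  FSet : Set₁
  FSet = Form → Set

  IsTheory : FSet → Set
  IsTheory s =
      (∀ φ → Thm φ → s φ)
    × (∀ φ ψ → s (φ ⇒ ψ) → s φ → s ψ)
    × (∀ (η : Adm) i φ
         → (∀ ψ → IsEL ψ → s (plug η (φ ∧' ([ ψ ] ¬' (K i φ)))))
         → s (plug η (U i φ)))

  IsMCT : FSet → Set
  IsMCT s = IsTheory s × (¬ s ⊥') × (∀ φ → s φ ⊎ s (¬' φ))

  Sᶜ : Set₁
  Sᶜ = Σ FSet IsMCT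

  Rᶜ : Agent → Sᶜ → Sᶜ → Set
  Rᶜ i (s , _) (t , _) = ∀ φ → s (K i φ) → t φ

  Vᶜ : ℕ → Sᶜ → Set
  Vᶜ p (s , _) = s (var p)

{-# OPTIONS --safe #-}
-- Left to right is the definition of Rᶜᵢ. For the converse let K_i ψ ∉ s,
-- and read g ⊢ φ as K_i (g → φ) ∈ s. Starting from ¬ψ, a Lindenbaum chain
-- of ⊢-consistent formulas g₀, g₁, … settles every formula (by deciding it)
-- and every instance of RU (by deriving its conclusion or consistently
-- refuting one of its premises). The formulas derivable from some gₖ form a
-- maximal consistent theory t with s Rᶜᵢ t and ψ ∉ t.
module Submission where

open import Defs
open import Axiom.ExcludedMiddle using (ExcludedMiddle)
open import Data.Bool using (Bool; true; false; not; _∧_; T)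
open import Data.Bool.Properties using (T-≡)
open import Data.Empty using (⊥; ⊥-elim)
open import Data.Fin using (Fin; zero; suc)
open import Data.List using (List; []; _∷_; _++_; map; cartesianProductWith; cartesianProduct; allFin)
open import Data.List.Membership.Propositional using (_∈_)
open import Data.List.Membership.Propositional.Properties
  using ( ∈-map⁺; ∈-map⁻; ∈-++⁺ˡ; ∈-++⁺ʳ; ∈-++⁻; ∈-allFin
        ; ∈-cartesianProductWith⁺; ∈-cartesianProduct⁺; ∈-cartesianProduct⁻)
open import Data.List.Relation.Binary.Subset.Propositional using (_⊆_)
open import Data.List.Relation.Binary.Subset.Propositional.Properties using (⊆-refl; ⊆-trans)
open import Data.List.Relation.Unary.Any using (here; there)
open import Data.Nat using (ℕ; zero; suc; _≤_; _≤′_; ≤′-refl; ≤′-step; _⊔_)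
open import Data.Nat.Properties using (≤⇒≤′; m≤m⊔n; m≤n⊔m)
open import Data.Product using (Σ; ∃; _×_; _,_; proj₁; proj₂)
open import Data.Sum using (_⊎_; inj₁; inj₂)
open import Data.Vec as Vec using (Vec; []; _∷_; lookup)
open import Data.Vec.Properties using (lookup-map)
open import Function using (_$_; _∘_; Equivalence)
open import Level using (0ℓ)
open import Relation.Binary using (Rel; Reflexive; Transitive)
open import Relation.Binary.PropositionalEquality using (_≡_; refl; sym; trans; cong; cong₂)
open import Relation.Nullary using (¬_; yes; no)
open import Relation.Nullary.Decidable using (decidable-stable)

stepwise⇒monotone : ∀ {a ℓ} {A : Set a} (_≼_ : Rel A ℓ) → Reflexive _≼_ → Transitive _≼_ →
                    (f : ℕ → A) → (∀ k → f k ≼ f (suc k)) → ∀ {k m} → k ≤ m → f k ≼ f m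
stepwise⇒monotone _≼_ ≼-refl ≼-trans f f≼f∘suc = go ∘ ≤⇒≤′
  where
    go : ∀ {k m} → k ≤′ m → f k ≼ f m
    go ≤′-refl = ≼-refl
    go (≤′-step k≤′m) = ≼-trans (go k≤′m) (f≼f∘suc _)

Upward : ∀ {p} → (ℕ → Set p) → Set p
Upward P = ∀ {k m} → k ≤ m → P k → P m

upward-∃-× : ∀ {p q} {P : ℕ → Set p} {Q : ℕ → Set q} →
             Upward P → Upward Q → ∃ P → ∃ Q → ∃ λ k → P k × Q k
upward-∃-× P↑ Q↑ (k , p) (m , q) = k ⊔ m , P↑ (m≤m⊔n k m) p , Q↑ (m≤n⊔m k m) q

module _ {A : Set} where

  Ascending : (ℕ → List A) → Set
  Ascending L = ∀ k → L k ⊆ L (suc k)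

  ascending⇒∈-upward : ∀ {L} → Ascending L → ∀ {x} → Upward (λ k → x ∈ L k)
  ascending⇒∈-upward {L} asc k≤m = stepwise⇒monotone _⊆_ ⊆-refl ⊆-trans L asc k≤m

record Exhaustion (A : Set) : Set where
  field
    level      : ℕ → List A
    ascending  : Ascending level
    exhaustive : ∀ x → ∃ λ k → x ∈ level k

open Exhaustion

exhaustion-Fin : ∀ m → Exhaustion (Fin m)
exhaustion-Fin m = record
  { level = λ _ → allFin m ; ascending = λ _ → ⊆-refl ; exhaustive = λ x → zero , ∈-allFin x }

exhaustion-× : ∀ {A B} → Exhaustion A → Exhaustion B → Exhaustion (A × B)
exhaustion-× EA EB = record
  { level = λ k → cartesianProduct (level EA k) (level EB k)
  ; ascending = λ k xy∈ → let x∈ , y∈ = ∈-cartesianProduct⁻ _ _ xy∈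
                         in ∈-cartesianProduct⁺ (ascending EA k x∈) (ascending EB k y∈)
  ; exhaustive = λ (x , y) →
      let k , x∈ , y∈ = upward-∃-× (ascending⇒∈-upward (ascending EA))
                                   (ascending⇒∈-upward (ascending EB))
                                   (exhaustive EA x) (exhaustive EB y)
      in k , ∈-cartesianProduct⁺ x∈ y∈
  }

exhaustion-⊎ : ∀ {A B} → Exhaustion A → Exhaustion B → Exhaustion (A ⊎ B)
exhaustion-⊎ {A} {B} EA EB = record { level = levels ; ascending = asc ; exhaustive = exh }
  where
    levels : ℕ → List (A ⊎ B)
    levels k = map inj₁ (level EA k) ++ map inj₂ (level EB k)

    asc : Ascending levels
    asc k z∈ with ∈-++⁻ (map inj₁ (level EA k)) z∈
    ... | inj₁ z∈₁ with x , x∈ , refl ← ∈-map⁻ inj₁ z∈₁ = ∈-++⁺ˡ (∈-map⁺ inj₁ (ascending EA k x∈))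
    ... | inj₂ z∈₂ with y , y∈ , refl ← ∈-map⁻ inj₂ z∈₂ = ∈-++⁺ʳ _ (∈-map⁺ inj₂ (ascending EB k y∈))

    exh : ∀ z → ∃ λ k → z ∈ levels k
    exh (inj₁ x) = let k , x∈ = exhaustive EA x in k , ∈-++⁺ˡ (∈-map⁺ inj₁ x∈)
    exh (inj₂ y) = let k , y∈ = exhaustive EB y in k , ∈-++⁺ʳ _ (∈-map⁺ inj₂ y∈)

infixl 6 _⊛_
_⊛_ : ∀ {A B : Set} → List (A → B) → List A → List B
_⊛_ = cartesianProductWith _$_

∈-⊛⁺ : ∀ {A B : Set} {fs : List (A → B)} {xs f x} → f ∈ fs → x ∈ xs → f x ∈ fs ⊛ xs
∈-⊛⁺ = ∈-cartesianProductWith⁺ _$_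

infixr 5 _⇒ˢ_
infixr 6 _∧ˢ_
infix 7 ¬ˢ_
data Schema (k : ℕ) : Set where
  atom   : Fin k → Schema k
  falsum : Schema k
  ¬ˢ_    : Schema k → Schema k
  _∧ˢ_   : Schema k → Schema k → Schema k

_⇒ˢ_ : ∀ {k} → Schema k → Schema k → Schema k
p ⇒ˢ q = ¬ˢ (p ∧ˢ ¬ˢ q)

x₀ : ∀ {k} → Schema (suc k)
x₀ = atom zero

x₁ : ∀ {k} → Schema (suc (suc k))
x₁ = atom (suc zero)

x₂ : ∀ {k} → Schema (suc (suc (suc k)))
x₂ = atom (suc (suc zero))

⟦_⟧ᵇ : ∀ {k} → Schema k → Vec Bool k → Bool
⟦ atom x ⟧ᵇ ρ = lookup ρ x
⟦ falsum ⟧ᵇ ρ = false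
⟦ ¬ˢ p ⟧ᵇ ρ = not (⟦ p ⟧ᵇ ρ)
⟦ p ∧ˢ q ⟧ᵇ ρ = ⟦ p ⟧ᵇ ρ ∧ ⟦ q ⟧ᵇ ρ

-- Stated with T so that, for a closed tautology, the evidence is a tuple of
-- units and can be left implicit.
TrueForAll : ∀ k → (Vec Bool k → Bool) → Set
TrueForAll zero f = T (f [])
TrueForAll (suc k) f = TrueForAll k (f ∘ (true ∷_)) × TrueForAll k (f ∘ (false ∷_))

TrueForAll-sound : ∀ {k} (f : Vec Bool k → Bool) → TrueForAll k f → ∀ ρ → f ρ ≡ true
TrueForAll-sound f holds [] = Equivalence.to (T-≡ {f []}) holds
TrueForAll-sound f (holds , _) (true ∷ ρ) = TrueForAll-sound (f ∘ (true ∷_)) holds ρ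
TrueForAll-sound f (_ , holds) (false ∷ ρ) = TrueForAll-sound (f ∘ (false ∷_)) holds ρ

module Instances (n : ℕ) where
  open LUT n

  ⟦_⟧ : ∀ {k} → Schema k → Vec Form k → Form
  ⟦ atom x ⟧ σ = lookup σ x
  ⟦ falsum ⟧ σ = ⊥'
  ⟦ ¬ˢ p ⟧ σ = ¬' (⟦ p ⟧ σ)
  ⟦ p ∧ˢ q ⟧ σ = ⟦ p ⟧ σ ∧' ⟦ q ⟧ σ

  evalP-⊥' : ∀ v → evalP v ⊥' ≡ false
  evalP-⊥' v = excluded (v (var zero))
    where
      excluded : ∀ b → not (not (b ∧ not b)) ≡ false
      excluded true = refl
      excluded false = refl

  evalP-⟦⟧ : ∀ v {k} (p : Schema k) σ → evalP v (⟦ p ⟧ σ) ≡ ⟦ p ⟧ᵇ (Vec.map (evalP v) σ)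
  evalP-⟦⟧ v (atom x) σ = sym (lookup-map x (evalP v) σ)
  evalP-⟦⟧ v falsum σ = evalP-⊥' v
  evalP-⟦⟧ v (¬ˢ p) σ = cong not (evalP-⟦⟧ v p σ)
  evalP-⟦⟧ v (p ∧ˢ q) σ = cong₂ _∧_ (evalP-⟦⟧ v p σ) (evalP-⟦⟧ v q σ)

  tautology : ∀ {k} (p : Schema k) {valid : TrueForAll k ⟦ p ⟧ᵇ} (σ : Vec Form k) → Thm (⟦ p ⟧ σ)
  tautology p {valid} σ = taut λ v → trans (evalP-⟦⟧ v p σ) (TrueForAll-sound ⟦ p ⟧ᵇ valid _)

  weakening : ∀ φ g → Thm (φ ⇒ g ⇒ φ)
  weakening φ g = tautology (x₀ ⇒ˢ x₁ ⇒ˢ x₀) (φ ∷ g ∷ [])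

  distribution : ∀ g φ χ → Thm ((g ⇒ φ ⇒ χ) ⇒ (g ⇒ φ) ⇒ g ⇒ χ)
  distribution g φ χ = tautology ((x₀ ⇒ˢ x₁ ⇒ˢ x₂) ⇒ˢ (x₀ ⇒ˢ x₁) ⇒ˢ x₀ ⇒ˢ x₂) (g ∷ φ ∷ χ ∷ [])

  strengthening : ∀ g c φ → Thm ((g ⇒ φ) ⇒ g ∧' c ⇒ φ)
  strengthening g c φ = tautology ((x₀ ⇒ˢ x₂) ⇒ˢ x₀ ∧ˢ x₁ ⇒ˢ x₂) (g ∷ c ∷ φ ∷ [])

  ∧-elimʳ : ∀ g c → Thm (g ∧' c ⇒ c)
  ∧-elimʳ g c = tautology (x₀ ∧ˢ x₁ ⇒ˢ x₁) (g ∷ c ∷ [])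

  ¬-intro : ∀ g c → Thm ((g ∧' c ⇒ ⊥') ⇒ g ⇒ ¬' c)
  ¬-intro g c = tautology ((x₀ ∧ˢ x₁ ⇒ˢ falsum) ⇒ˢ x₀ ⇒ˢ ¬ˢ x₁) (g ∷ c ∷ [])

  by-contradiction : ∀ g c → Thm ((g ∧' ¬' c ⇒ ⊥') ⇒ g ⇒ c)
  by-contradiction g c = tautology ((x₀ ∧ˢ ¬ˢ x₁ ⇒ˢ falsum) ⇒ˢ x₀ ⇒ˢ x₁) (g ∷ c ∷ [])

  ¬-elim : ∀ φ → Thm ((¬' φ ⇒ ⊥') ⇒ φ)
  ¬-elim φ = tautology ((¬ˢ x₀ ⇒ˢ falsum) ⇒ˢ x₀) (φ ∷ [])

  explosion : ∀ φ → Thm (φ ⇒ ¬' φ ⇒ ⊥')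
  explosion φ = tautology (x₀ ⇒ˢ ¬ˢ x₀ ⇒ˢ falsum) (φ ∷ [])

  identity : ∀ φ → Thm (φ ⇒ φ)
  identity φ = tautology (x₀ ⇒ˢ x₀) (φ ∷ [])

module Enumeration (n : ℕ) where
  open LUT n

  unaryConnectives : List (Form → Form)
  unaryConnectives = ¬' ∷ map K (allFin n) ++ map U (allFin n)

  binaryConnectives : List (Form → Form → Form)
  binaryConnectives = _∧'_ ∷ [_]_ ∷ []

  formsOfRank : ℕ → List Form
  formsOfRank zero = []
  formsOfRank (suc k) = var k ∷ formsOfRank k
    ++ unaryConnectives ⊛ formsOfRank k
    ++ binaryConnectives ⊛ formsOfRank k ⊛ formsOfRank k

  formsOfRank-ascending : Ascending formsOfRank
  formsOfRank-ascending k = there ∘ ∈-++⁺ˡ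

  formsOfRank-unary : ∀ {f φ} → f ∈ unaryConnectives →
                      ∃ (λ k → φ ∈ formsOfRank k) → ∃ λ k → f φ ∈ formsOfRank k
  formsOfRank-unary f∈ (k , φ∈) = suc k , there (∈-++⁺ʳ (formsOfRank k) (∈-++⁺ˡ (∈-⊛⁺ f∈ φ∈)))

  formsOfRank-binary : ∀ {f φ χ} → f ∈ binaryConnectives →
                       ∃ (λ k → φ ∈ formsOfRank k) → ∃ (λ k → χ ∈ formsOfRank k) →
                       ∃ λ k → f φ χ ∈ formsOfRank k
  formsOfRank-binary f∈ φ∈ χ∈ =
    let k , φ∈′ , χ∈′ = upward-∃-× (ascending⇒∈-upward formsOfRank-ascending)
                                   (ascending⇒∈-upward formsOfRank-ascending) φ∈ χ∈
    in suc k , there (∈-++⁺ʳ (formsOfRank k) (∈-++⁺ʳ _ (∈-⊛⁺ (∈-⊛⁺ f∈ φ∈′) χ∈′)))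

  formsOfRank-exhaustive : ∀ φ → ∃ λ k → φ ∈ formsOfRank k
  formsOfRank-exhaustive (var p) = suc p , here refl
  formsOfRank-exhaustive (¬' φ) = formsOfRank-unary (here refl) (formsOfRank-exhaustive φ)
  formsOfRank-exhaustive (φ ∧' χ) =
    formsOfRank-binary (here refl) (formsOfRank-exhaustive φ) (formsOfRank-exhaustive χ)
  formsOfRank-exhaustive (K j φ) =
    formsOfRank-unary (there (∈-++⁺ˡ (∈-map⁺ K (∈-allFin j)))) (formsOfRank-exhaustive φ)
  formsOfRank-exhaustive ([ φ ] χ) =
    formsOfRank-binary (there (here refl)) (formsOfRank-exhaustive φ) (formsOfRank-exhaustive χ)
  formsOfRank-exhaustive (U j φ) =
    formsOfRank-unary (there (∈-++⁺ʳ _ (∈-map⁺ U (∈-allFin j)))) (formsOfRank-exhaustive φ)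

  forms : Exhaustion Form
  forms = record
    { level = formsOfRank ; ascending = formsOfRank-ascending ; exhaustive = formsOfRank-exhaustive }

  admsOfRank : ℕ → List Adm
  admsOfRank zero = []
  admsOfRank (suc k) = ♯ ∷ admsOfRank k
    ++ map Kη (allFin n) ⊛ admsOfRank k
    ++ (_⇒η_ ∷ [_]η_ ∷ []) ⊛ formsOfRank k ⊛ admsOfRank k

  admsOfRank-ascending : Ascending admsOfRank
  admsOfRank-ascending k = there ∘ ∈-++⁺ˡ

  admsOfRank-formBinder : ∀ {f φ η} → f ∈ _⇒η_ ∷ [_]η_ ∷ [] →
                          ∃ (λ k → φ ∈ formsOfRank k) → ∃ (λ k → η ∈ admsOfRank k) →
                          ∃ λ k → f φ η ∈ admsOfRank k
  admsOfRank-formBinder f∈ φ∈ η∈ =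
    let k , φ∈′ , η∈′ = upward-∃-× (ascending⇒∈-upward formsOfRank-ascending)
                                   (ascending⇒∈-upward admsOfRank-ascending) φ∈ η∈
    in suc k , there (∈-++⁺ʳ (admsOfRank k) (∈-++⁺ʳ _ (∈-⊛⁺ (∈-⊛⁺ f∈ φ∈′) η∈′)))

  admsOfRank-exhaustive : ∀ η → ∃ λ k → η ∈ admsOfRank k
  admsOfRank-exhaustive ♯ = 1 , here refl
  admsOfRank-exhaustive (Kη j η) =
    let k , η∈ = admsOfRank-exhaustive η
    in suc k , there (∈-++⁺ʳ (admsOfRank k) (∈-++⁺ˡ (∈-⊛⁺ (∈-map⁺ Kη (∈-allFin j)) η∈)))
  admsOfRank-exhaustive (φ ⇒η η) =
    admsOfRank-formBinder (here refl) (formsOfRank-exhaustive φ) (admsOfRank-exhaustive η)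
  admsOfRank-exhaustive ([ φ ]η η) =
    admsOfRank-formBinder (there (here refl)) (formsOfRank-exhaustive φ) (admsOfRank-exhaustive η)

  adms : Exhaustion Adm
  adms = record
    { level = admsOfRank ; ascending = admsOfRank-ascending ; exhaustive = admsOfRank-exhaustive }

module RelativeLindenbaum (n : ℕ) (em : ExcludedMiddle 0ℓ)
                          (S : LUT.FSet n) (S-theory : LUT.IsTheory n S) (i : LUT.Agent n) where
  open LUT n
  open Instances n
  open Enumeration n using (forms; adms)

  private
    S-thm : ∀ φ → Thm φ → S φ
    S-thm = proj₁ S-theory

    S-mp : ∀ φ χ → S (φ ⇒ χ) → S φ → S χ
    S-mp = proj₁ (proj₂ S-theory)

  K-thm : ∀ {φ} → Thm φ → S (K i φ)
  K-thm th = S-thm _ (necK i th)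

  K-mp : ∀ {φ χ} → S (K i (φ ⇒ χ)) → S (K i φ) → S (K i χ)
  K-mp {φ} {χ} Kφ⇒χ Kφ = S-mp _ _ (S-mp _ _ (S-thm _ (axK i φ χ)) Kφ⇒χ) Kφ

  K-mono : ∀ {φ χ} → Thm (φ ⇒ χ) → S (K i φ) → S (K i χ)
  K-mono th = K-mp (K-thm th)

  infix 4 _⊢_ _≼_

  _⊢_ : Form → Form → Set
  g ⊢ φ = S (K i (g ⇒ φ))

  Consistent : Form → Set
  Consistent g = ¬ g ⊢ ⊥'

  _≼_ : Form → Form → Set
  g ≼ g′ = ∀ {φ} → g ⊢ φ → g′ ⊢ φ

  ≼-refl : Reflexive _≼_
  ≼-refl g⊢φ = g⊢φ

  ≼-trans : Transitive _≼_
  ≼-trans g≼g′ g′≼g″ g⊢φ = g′≼g″ (g≼g′ g⊢φ)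

  ⊢-thm : ∀ {g φ} → Thm φ → g ⊢ φ
  ⊢-thm {g} {φ} th = K-thm (mp (weakening φ g) th)

  ⊢-mp : ∀ {g φ χ} → g ⊢ φ ⇒ χ → g ⊢ φ → g ⊢ χ
  ⊢-mp {g} {φ} {χ} g⊢φ⇒χ = K-mp (K-mono (distribution g φ χ) g⊢φ⇒χ)

  ⊢-explosion : ∀ {g φ} → g ⊢ φ → g ⊢ ¬' φ → g ⊢ ⊥'
  ⊢-explosion {φ = φ} g⊢φ g⊢¬φ = ⊢-mp (⊢-mp (⊢-thm (explosion φ)) g⊢φ) g⊢¬φ

  ≼-∧ : ∀ {g c} → g ≼ g ∧' c
  ≼-∧ {g} {c} {φ} = K-mono (strengthening g c φ)

  ∧-⊢ : ∀ {g c} → g ∧' c ⊢ c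
  ∧-⊢ {g} {c} = K-thm (∧-elimʳ g c)

  ⊢-¬-intro : ∀ {g c} → g ∧' c ⊢ ⊥' → g ⊢ ¬' c
  ⊢-¬-intro {g} {c} = K-mono (¬-intro g c)

  ⊢-by-contradiction : ∀ {g c} → g ∧' ¬' c ⊢ ⊥' → g ⊢ c
  ⊢-by-contradiction {g} {c} = K-mono (by-contradiction g c)

  ¬consistent⇒⊢⊥ : ∀ {g} → ¬ Consistent g → g ⊢ ⊥'
  ¬consistent⇒⊢⊥ = decidable-stable em

  ru-premise : Adm → Agent → Form → Form → Form
  ru-premise η j φ ψ = plug η (φ ∧' [ ψ ] ¬' (K j φ))

  -- s is closed under RU for the admissible form K_i (g → η(♯)).
  ⊢-ru : ∀ {g} η j φ → (∀ ψ → IsEL ψ → g ⊢ ru-premise η j φ ψ) → g ⊢ plug η (U j φ)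
  ⊢-ru {g} η = proj₂ (proj₂ S-theory) (Kη i (g ⇒η η))

  Task : Set
  Task = Form ⊎ (Adm × Agent × Form)

  tasks : Exhaustion Task
  tasks = exhaustion-⊎ forms (exhaustion-× adms (exhaustion-× (exhaustion-Fin n) forms))

  Settled : Task → Form → Set
  Settled (inj₁ φ) g = g ⊢ φ ⊎ g ⊢ ¬' φ
  Settled (inj₂ (η , j , φ)) g = g ⊢ plug η (U j φ) ⊎ ∃ λ ψ → IsEL ψ × g ⊢ ¬' (ru-premise η j φ ψ)

  settled-≼ : ∀ t {g g′} → g ≼ g′ → Settled t g → Settled t g′
  settled-≼ (inj₁ φ) g≼g′ (inj₁ g⊢φ) = inj₁ (g≼g′ g⊢φ)
  settled-≼ (inj₁ φ) g≼g′ (inj₂ g⊢¬φ) = inj₂ (g≼g′ g⊢¬φ)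
  settled-≼ (inj₂ _) g≼g′ (inj₁ g⊢U) = inj₁ (g≼g′ g⊢U)
  settled-≼ (inj₂ _) g≼g′ (inj₂ (ψ , el , refuted)) = inj₂ (ψ , el , g≼g′ refuted)

  ConsistentExtension : Form → (Form → Set) → Set
  ConsistentExtension g P = ∃ λ g′ → Consistent g′ × g ≼ g′ × P g′

  settle : ∀ t g → Consistent g → ConsistentExtension g (Settled t)
  settle (inj₁ φ) g con with em {Consistent (g ∧' φ)}
  ... | yes con′ = g ∧' φ , con′ , ≼-∧ , inj₁ ∧-⊢
  ... | no incon = g , con , ≼-refl , inj₂ (⊢-¬-intro (¬consistent⇒⊢⊥ incon))
  settle (inj₂ (η , j , φ)) g con
    with em {∃ λ ψ → IsEL ψ × Consistent (g ∧' ¬' (ru-premise η j φ ψ))}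
  ... | yes (ψ , el , con′) = g ∧' ¬' (ru-premise η j φ ψ) , con′ , ≼-∧ , inj₂ (ψ , el , ∧-⊢)
  ... | no none = g , con , ≼-refl , inj₁ (⊢-ru η j φ derivable)
    where
      derivable : ∀ ψ → IsEL ψ → g ⊢ ru-premise η j φ ψ
      derivable ψ el = ⊢-by-contradiction (¬consistent⇒⊢⊥ λ con′ → none (ψ , el , con′))

  Stage : Set
  Stage = Σ Form Consistent

  settleAll : List Task → Stage → Stage
  settleAll [] s = s
  settleAll (t ∷ ts) (g , con) with settle t g con
  ... | g′ , con′ , _ = settleAll ts (g′ , con′)

  settleAll-≼ : ∀ ts s → proj₁ s ≼ proj₁ (settleAll ts s)
  settleAll-≼ [] s = ≼-refl
  settleAll-≼ (t ∷ ts) (g , con) with settle t g con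
  ... | g′ , con′ , g≼g′ , _ = ≼-trans g≼g′ (settleAll-≼ ts (g′ , con′))

  settleAll-settles : ∀ ts s {t} → t ∈ ts → Settled t (proj₁ (settleAll ts s))
  settleAll-settles (t ∷ ts) (g , con) (here refl) with settle t g con
  ... | g′ , con′ , _ , settled = settled-≼ t (settleAll-≼ ts (g′ , con′)) settled
  settleAll-settles (t ∷ ts) (g , con) (there t∈ts) with settle t g con
  ... | g′ , con′ , _ = settleAll-settles ts (g′ , con′) t∈ts

  module Chain (ψ : Form) (K-ψ∉S : ¬ S (K i ψ)) where

    stage : ℕ → Stage
    stage zero = ¬' ψ , λ ¬ψ⊢⊥ → K-ψ∉S (K-mono (¬-elim ψ) ¬ψ⊢⊥)
    stage (suc k) = settleAll (level tasks k) (stage k)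

    γ : ℕ → Form
    γ = proj₁ ∘ stage

    γ-consistent : ∀ k → Consistent (γ k)
    γ-consistent = proj₂ ∘ stage

    ⊢-upward : ∀ {φ} → Upward (λ k → γ k ⊢ φ)
    ⊢-upward k≤m =
      stepwise⇒monotone _≼_ ≼-refl ≼-trans γ (λ k → settleAll-≼ (level tasks k) (stage k)) k≤m

    eventually-settled : ∀ t → ∃ λ k → Settled t (γ k)
    eventually-settled t =
      let k , t∈ = exhaustive tasks t in suc k , settleAll-settles _ (stage k) t∈

    Limit : FSet
    Limit φ = ∃ λ k → γ k ⊢ φ

    limit-common-stage : ∀ {φ χ} → Limit φ → Limit χ → ∃ λ k → γ k ⊢ φ × γ k ⊢ χ
    limit-common-stage = upward-∃-× ⊢-upward ⊢-upward

    limit-contradiction : ∀ {φ} → Limit φ → Limit (¬' φ) → ⊥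
    limit-contradiction φ∈ ¬φ∈ =
      let k , γ⊢φ , γ⊢¬φ = limit-common-stage φ∈ ¬φ∈ in γ-consistent k (⊢-explosion γ⊢φ γ⊢¬φ)

    limit-ru : ∀ η j φ → (∀ χ → IsEL χ → Limit (ru-premise η j φ χ)) → Limit (plug η (U j φ))
    limit-ru η j φ premises with eventually-settled (inj₂ (η , j , φ))
    ... | k , inj₁ γ⊢U = k , γ⊢U
    ... | k , inj₂ (χ , el , refuted) = ⊥-elim (limit-contradiction (premises χ el) (k , refuted))

    limit-decides : ∀ φ → Limit φ ⊎ Limit (¬' φ)
    limit-decides φ with eventually-settled (inj₁ φ)
    ... | k , inj₁ γ⊢φ = inj₁ (k , γ⊢φ)
    ... | k , inj₂ γ⊢¬φ = inj₂ (k , γ⊢¬φ)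

    limit-mct : IsMCT Limit
    limit-mct = ( (λ _ th → zero , ⊢-thm th)
                , (λ _ _ φ⇒χ∈ φ∈ → let k , γ⊢φ⇒χ , γ⊢φ = limit-common-stage φ⇒χ∈ φ∈
                                   in k , ⊢-mp γ⊢φ⇒χ γ⊢φ)
                , limit-ru )
              , (λ (k , γ⊢⊥) → γ-consistent k γ⊢⊥)
              , limit-decides

  lindenbaum : ∀ ψ → ¬ S (K i ψ) → ∃ λ (t : Sᶜ) → (∀ φ → S (K i φ) → proj₁ t φ) × ¬ proj₁ t ψ
  lindenbaum ψ K-ψ∉S =
      (Limit , limit-mct)
    , (λ φ Kφ → zero , K-mono (weakening φ (¬' ψ)) Kφ)
    , (λ ψ∈ → limit-contradiction ψ∈ (zero , K-thm (identity (¬' ψ))))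
    where open Chain ψ K-ψ∉S

mainTheorem19 : ExcludedMiddle 0ℓ → (n : ℕ) →
    let open LUT n in
      ∀ (s : Sᶜ) (i : Agent) (ψ : Form) →
        (proj₁ s (K i ψ) → ∀ (t : Sᶜ) → Rᶜ i s t → proj₁ t ψ)
      × ((∀ (t : Sᶜ) → Rᶜ i s t → proj₁ t ψ) → proj₁ s (K i ψ))
mainTheorem19 em n (S , S-theory , _) i ψ =
    (λ Kψ t sRt → sRt ψ Kψ)
  , λ ψ-everywhere → decidable-stable em λ K-ψ∉S →
      let t , sRt , ψ∉t = lindenbaum ψ K-ψ∉S in ψ∉t (ψ-everywhere t sRt)
  where open RelativeLindenbaum n em S S-theory i
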